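{- Let $G$ be a directed graph with vertex set $[n]$ and let $s,t\in[n]$. Let $A$ be its adjacency matrix, with $A_{u,v}=1$ if $u\neq v$ and $(u,v)$ is an edge, and $A_{u,v}=0$ otherwise. Let $B=nI-A$. Let $b\in\mathbb{Q}^n$ have $b_t=1$ and all other entries $0$; let $B'$ be the $(n+1)\times n$ matrix obtained from $B$ by appending a row with $1$ in column $s$ and $0$ elsewhere; let $b'\in\mathbb{Q}^{n+1}$ be $b$ extended by a final entry $0$; and let $(B'\mid b')$ be the $(n+1)\times(n+1)$ matrix obtained by appending column $b'$ to $B'$. Then there is a directed path from $s$ to $t$ in $G$ if and only if $\mathrm{rank}(B'\mid b')=n+1$. -}

module Defs where

open import Data.Nat using (ℕ; zero; suc)
open import Data.Integer using (+_)
open import Data.Bool using (Bool; true; false; if_then_else_)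
open import Data.Fin using (Fin; fromℕ; _≟_)
open import Data.Rational using (ℚ; 0ℚ; 1ℚ; _+_; _*_; _-_; _/_)
open import Data.Vec.Functional using (Vector; insertAt)
open import Data.Product using (Σ; _×_)
open import Function.Definitions using (Injective)
open import Relation.Binary.PropositionalEquality using (_≡_)
open import Relation.Binary.Construct.Closure.ReflexiveTransitive using (Star)
open import Relation.Nullary using (¬_; does)

DiGraph : ℕ → Set
DiGraph n = Fin n → Fin n → Bool

Edge : ∀ {n} → DiGraph n → Fin n → Fin n → Set
Edge G u v = G u v ≡ true

HasPath : ∀ {n} → DiGraph n → Fin n → Fin n → Set
HasPath G s t = Star (Edge G) s t

Matrix : ℕ → ℕ → Set
Matrix m k = Fin m → Fin k → ℚ

ℕ→ℚ : ℕ → ℚ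
ℕ→ℚ n = (+ n) / 1

∑ : ∀ {r} → (Fin r → ℚ) → ℚ
∑ {zero} f = 0ℚ
∑ {suc r} f = f Fin.zero + ∑ (λ i → f (Fin.suc i))

LinIndepCols : ∀ {m k r} → Matrix m k → (Fin r → Fin k) → Set
LinIndepCols {m} {k} {r} M f =
  (c : Fin r → ℚ) → (∀ i → ∑ (λ j → c j * M i (f j)) ≡ 0ℚ) → ∀ j → c j ≡ 0ℚ

HasRank : ∀ {m k} → Matrix m k → ℕ → Set
HasRank {m} {k} M r =
  Σ (Fin r → Fin k) (λ f → Injective _≡_ _≡_ f × LinIndepCols M f)
  × ((g : Fin (suc r) → Fin k) → Injective _≡_ _≡_ g → ¬ LinIndepCols M g)

adjMatrix : ∀ {n} → DiGraph n → Matrix n n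
adjMatrix G u v =
  if does (u ≟ v) then 0ℚ else (if G u v then 1ℚ else 0ℚ)

idMatrix : ∀ {n} → Matrix n n
idMatrix u v = if does (u ≟ v) then 1ℚ else 0ℚ

Bmat : ∀ {n} → DiGraph n → Matrix n n
Bmat {n} G u v = ℕ→ℚ n * idMatrix u v - adjMatrix G u v

unitVec : ∀ {n} → Fin n → Vector ℚ n
unitVec t v = if does (v ≟ t) then 1ℚ else 0ℚ

B'mat : ∀ {n} → DiGraph n → Fin n → Matrix (suc n) n
B'mat {n} G s = insertAt (Bmat G) (fromℕ n) (unitVec s)

b'vec : ∀ {n} → Fin n → Vector ℚ (suc n)
b'vec {n} t = insertAt (unitVec t) (fromℕ n) 0ℚ

augMatrix : ∀ {n} → DiGraph n → Fin n → Fin n → Matrix (suc n) (suc n)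
augMatrix {n} G s t i = insertAt (B'mat G s i) (fromℕ n) (b'vec t i)

-- Write M = (B' | b') and read a column vector x of length n + 1 as (y, α) with
-- y = init x and α = last x.  The rows of M say (M x)ᵤ = (B y)ᵤ + α·δᵤₜ for u < n
-- and (M x)ₙ = y_s.  Everything rests on a discrete minimum principle for
-- B = nI − A: a vertex has at most n − 1 out-neighbours, so where z attains a
-- minimum m ≤ 0 we get (B z)ᵤ ≤ m.  Hence B z ≥ 0 forces z ≥ 0, and B z = 0
-- forces z = 0.  Call z harmonic off t when (B z)ᵤ = 0 for all u ≠ t.
--   (⇒) Along a path s ⇝ t, a zero of a harmonic-off-t potential z ≥ 0 spreads
--   to out-neighbours and reaches t, forcing (B z)_t ≤ 0.  So if M x = 0 then
--   α = 0 (otherwise y, up to sign, is such a potential with y_s = 0), then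
--   B y = 0 and y = 0: the columns of M are independent.
--   (⇐) n + 1 independent columns of M give, by Gaussian elimination on the first
--   n rows, an x with (M x)ᵤ = 0 for u < n but y_s = (M x)ₙ ≠ 0.  Then y is harmonic
--   off t, and from s one climbs to strictly larger values of ±y until reaching t.
module Submission where

open import Defs
open import Algebra.Bundles using (CommutativeRing)
import Algebra.Properties.Semiring.Sum as SemiringSum
open import Data.Bool using (true; false; if_then_else_)
open import Data.Empty using (⊥-elim)
open import Data.Fin using (Fin; zero; suc; fromℕ; inject₁; punchIn; _≟_)
open import Data.Fin.Properties using (any?; pigeonhole; punchInᵢ≢i; <-irrefl)
open import Data.Fin.Subset using (Subset; _∈_; ∣_∣)
open import Data.Fin.Subset.Properties using (p⊂q⇒∣p∣<∣q∣)
import Data.Integer as ℤ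
import Data.Integer.Properties as ℤₚ
open import Data.Nat using (ℕ; zero; suc; s≤s⁻¹) renaming (_<_ to _<ₙ_)
import Data.Nat.Properties as ℕ
open import Data.Product using (Σ; ∃; _×_; _,_; proj₁; proj₂)
open import Data.Rational using (ℚ; 0ℚ; 1ℚ; _+_; _*_; _-_; -_; _≤_; _<_; 1/_; NonZero; ≢-nonZero; toℚᵘ)
import Data.Rational.Properties as ℚ
open import Data.Rational.Solver using (module +-*-Solver)
import Data.Rational.Unnormalised as ℚᵘ
import Data.Rational.Unnormalised.Properties as ℚᵘ
open import Data.Vec using (tabulate)
open import Data.Vec.Properties using (lookup∘tabulate; []=⇒lookup; lookup⇒[]=)
open import Data.Vec.Functional using (insertAt; init; last)
open import Data.Vec.Functional.Properties using (insertAt-lookup; insertAt-punchIn)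
open import Function using (id; _∘_)
open import Function.Definitions using (Injective)
open import Function.Bundles using (_⇔_; mk⇔)
open import Relation.Binary.Construct.Closure.ReflexiveTransitive using (ε; _◅_)
open import Relation.Binary.Definitions using (tri<; tri≈; tri>)
open import Relation.Binary.PropositionalEquality
open import Relation.Nullary using (¬_; Dec; does; yes; no; ¬?; _×-dec_)
open import Relation.Nullary.Decidable using (dec-true; decidable-stable)

open +-*-Solver using (solve; _:=_; _:+_; _:*_; :-_; _:-_; con)

module Sum = SemiringSum (CommutativeRing.semiring ℚ.+-*-commutativeRing)

∑≡sum : ∀ {r} (f : Fin r → ℚ) → ∑ f ≡ Sum.sum f
∑≡sum {zero} f = refl
∑≡sum {suc r} f = cong (f zero +_) (∑≡sum (f ∘ suc))

∑-cong : ∀ {r} {f g : Fin r → ℚ} → (∀ i → f i ≡ g i) → ∑ f ≡ ∑ g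
∑-cong {f = f} {g} f≗g = trans (∑≡sum f) (trans (Sum.sum-cong-≗ f≗g) (sym (∑≡sum g)))

∑-+ : ∀ {r} (f g : Fin r → ℚ) → ∑ (λ i → f i + g i) ≡ ∑ f + ∑ g
∑-+ f g = trans (∑≡sum (λ i → f i + g i)) (trans (Sum.∑-distrib-+ f g) (sym (cong₂ _+_ (∑≡sum f) (∑≡sum g))))

∑-*ˡ : ∀ {r} (c : ℚ) (f : Fin r → ℚ) → ∑ (λ i → c * f i) ≡ c * ∑ f
∑-*ˡ c f = trans (∑≡sum (λ i → c * f i)) (trans (sym (Sum.*-distribˡ-sum c f)) (cong (c *_) (sym (∑≡sum f))))

∑-*ʳ : ∀ {r} (f : Fin r → ℚ) (c : ℚ) → ∑ (λ i → f i * c) ≡ ∑ f * c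
∑-*ʳ f c = trans (∑≡sum (λ i → f i * c)) (trans (sym (Sum.*-distribʳ-sum c f)) (cong (_* c) (sym (∑≡sum f))))

∑-zero : ∀ {r} → ∑ {r} (λ _ → 0ℚ) ≡ 0ℚ
∑-zero {r} = trans (∑≡sum {r} (λ _ → 0ℚ)) (Sum.sum-replicate-zero r)

∑-swap : ∀ {a b} (f : Fin a → Fin b → ℚ) → ∑ (λ i → ∑ (f i)) ≡ ∑ (λ j → ∑ (λ i → f i j))
∑-swap f = begin
  ∑ (λ i → ∑ (f i))                    ≡⟨ ∑-cong (λ i → ∑≡sum (f i)) ⟩
  ∑ (λ i → Sum.sum (f i))              ≡⟨ ∑≡sum (λ i → Sum.sum (f i)) ⟩
  Sum.sum (λ i → Sum.sum (f i))        ≡⟨ Sum.∑-comm f ⟩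
  Sum.sum (λ j → Sum.sum (λ i → f i j)) ≡⟨ sym (∑≡sum (λ j → Sum.sum (λ i → f i j))) ⟩
  ∑ (λ j → Sum.sum (λ i → f i j))      ≡⟨ ∑-cong (λ j → sym (∑≡sum (λ i → f i j))) ⟩
  ∑ (λ j → ∑ (λ i → f i j))            ∎
  where open ≡-Reasoning

∑-init-last : ∀ {r} (f : Fin (suc r) → ℚ) → ∑ f ≡ ∑ (init f) + last f
∑-init-last f = trans (∑≡sum f) (trans (Sum.sum-init-last f) (cong (_+ last f) (sym (∑≡sum (init f)))))

∑-remove : ∀ {r} (u : Fin (suc r)) (f : Fin (suc r) → ℚ) → ∑ f ≡ f u + ∑ (f ∘ punchIn u)
∑-remove u f = trans (∑≡sum f) (trans (Sum.sum-remove f) (cong (f u +_) (sym (∑≡sum (f ∘ punchIn u)))))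

∑-neg : ∀ {r} (f : Fin r → ℚ) → ∑ (λ i → - f i) ≡ - ∑ f
∑-neg {zero} f = refl
∑-neg {suc r} f = trans (cong (- f zero +_) (∑-neg (f ∘ suc))) (sym (ℚ.neg-distrib-+ (f zero) _))

∑-mono : ∀ {r} {f g : Fin r → ℚ} → (∀ i → f i ≤ g i) → ∑ f ≤ ∑ g
∑-mono {zero} f≤g = ℚ.≤-refl
∑-mono {suc r} f≤g = ℚ.+-mono-≤ (f≤g zero) (∑-mono (f≤g ∘ suc))

ℕ→ℚ-suc : ∀ r → ℕ→ℚ (suc r) ≡ 1ℚ + ℕ→ℚ r
ℕ→ℚ-suc r = ℚ.toℚᵘ-injective (begin-equality
  toℚᵘ (ℕ→ℚ (suc r))              ≃⟨ ℚ.toℚᵘ-fromℚᵘ (ℚᵘ.mkℚᵘ (ℤ.+ suc r) 0) ⟩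
  ℚᵘ.mkℚᵘ (ℤ.+ suc r) 0                ≃⟨ one-plus ⟩
  ℚᵘ.1ℚᵘ ℚᵘ.+ ℚᵘ.mkℚᵘ (ℤ.+ r) 0        ≃⟨ ℚᵘ.+-congʳ ℚᵘ.1ℚᵘ (ℚᵘ.≃-sym (ℚ.toℚᵘ-fromℚᵘ (ℚᵘ.mkℚᵘ (ℤ.+ r) 0))) ⟩
  ℚᵘ.1ℚᵘ ℚᵘ.+ toℚᵘ (ℕ→ℚ r)         ≃⟨ ℚᵘ.≃-sym (ℚ.toℚᵘ-homo-+ 1ℚ (ℕ→ℚ r)) ⟩
  toℚᵘ (1ℚ + ℕ→ℚ r)                  ∎)
  where
  open ℚᵘ.≤-Reasoning
  one-plus : ℚᵘ.mkℚᵘ (ℤ.+ suc r) 0 ℚᵘ.≃ ℚᵘ.1ℚᵘ ℚᵘ.+ ℚᵘ.mkℚᵘ (ℤ.+ r) 0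
  one-plus = ℚᵘ.*≡* (trans (ℤₚ.*-identityʳ _) (sym (trans (ℤₚ.*-identityʳ _)
    (cong₂ ℤ._+_ (ℤₚ.*-identityʳ (ℤ.+ 1)) (ℤₚ.*-identityʳ (ℤ.+ r))))))

∑-const : ∀ {r} (b : ℚ) → ∑ {r} (λ _ → b) ≡ ℕ→ℚ r * b
∑-const {zero} b = sym (ℚ.*-zeroˡ b)
∑-const {suc r} b = begin
  b + ∑ {r} (λ _ → b)  ≡⟨ cong (b +_) (∑-const {r} b) ⟩
  b + ℕ→ℚ r * b        ≡⟨ solve 2 (λ b x → b :+ x :* b := (con 1ℚ :+ x) :* b) refl b (ℕ→ℚ r) ⟩
  (1ℚ + ℕ→ℚ r) * b     ≡⟨ cong (_* b) (sym (ℕ→ℚ-suc r)) ⟩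
  ℕ→ℚ (suc r) * b      ∎
  where open ≡-Reasoning

∑-single : ∀ {r} (f : Fin r → ℚ) (u : Fin r) → (∀ w → w ≢ u → f w ≡ 0ℚ) → ∑ f ≡ f u
∑-single {suc r} f u others = begin
  ∑ f                       ≡⟨ ∑-remove u f ⟩
  f u + ∑ (f ∘ punchIn u)   ≡⟨ cong (f u +_) (trans (∑-cong (λ w → others _ (punchInᵢ≢i u w))) (∑-zero {r})) ⟩
  f u + 0ℚ                  ≡⟨ ℚ.+-identityʳ (f u) ⟩
  f u                       ∎
  where open ≡-Reasoning

∑≤term : ∀ {r} (f : Fin r → ℚ) (u : Fin r) → (∀ w → w ≢ u → f w ≤ 0ℚ) → ∑ f ≤ f u
∑≤term {suc r} f u others = begin
  ∑ f                       ≡⟨ ∑-remove u f ⟩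
  f u + ∑ (f ∘ punchIn u)   ≤⟨ ℚ.+-monoʳ-≤ (f u) (∑-mono (λ w → others _ (punchInᵢ≢i u w))) ⟩
  f u + ∑ {r} (λ _ → 0ℚ)    ≡⟨ cong (f u +_) (∑-zero {r}) ⟩
  f u + 0ℚ                  ≡⟨ ℚ.+-identityʳ (f u) ⟩
  f u                       ∎
  where open ℚ.≤-Reasoning

-- A sum of r terms whose u-th term is at most r·m while every other term is at
-- most −m is at most m: the arithmetic behind the minimum principle for nI − A.
∑-diagonal-bound : ∀ {r} (f : Fin r → ℚ) (u : Fin r) (m : ℚ) →
  f u ≤ ℕ→ℚ r * m → (∀ w → w ≢ u → f w ≤ - m) → ∑ f ≤ m
∑-diagonal-bound {suc r} f u m diagonal others = begin
  ∑ f                                   ≡⟨ ∑-remove u f ⟩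
  f u + ∑ (f ∘ punchIn u)               ≤⟨ ℚ.+-mono-≤ diagonal (∑-mono (λ w → others _ (punchInᵢ≢i u w))) ⟩
  ℕ→ℚ (suc r) * m + ∑ {r} (λ _ → - m)   ≡⟨ cong₂ _+_ (cong (_* m) (ℕ→ℚ-suc r)) (∑-const {r} (- m)) ⟩
  (1ℚ + ℕ→ℚ r) * m + ℕ→ℚ r * - m        ≡⟨ solve 2 (λ x m → (con 1ℚ :+ x) :* m :+ x :* (:- m) := m) refl (ℕ→ℚ r) m ⟩
  m                                     ∎
  where open ℚ.≤-Reasoning

δ : ∀ {r} → Fin r → Fin r → ℚ
δ a b = if does (a ≟ b) then 1ℚ else 0ℚ

δ-refl : ∀ {r} (a : Fin r) → δ a a ≡ 1ℚ
δ-refl a with a ≟ a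
... | yes _ = refl
... | no a≢a = ⊥-elim (a≢a refl)

δ-off : ∀ {r} {a b : Fin r} → a ≢ b → δ a b ≡ 0ℚ
δ-off {a = a} {b} a≢b with a ≟ b
... | yes a≡b = ⊥-elim (a≢b a≡b)
... | no _ = refl

∑-δ : ∀ {r} (a : Fin r) (h : Fin r → ℚ) → ∑ (λ k → δ a k * h k) ≡ h a
∑-δ a h = trans (∑-single (λ k → δ a k * h k) a off) (trans (cong (_* h a) (δ-refl a)) (ℚ.*-identityˡ (h a)))
  where
  off : ∀ k → k ≢ a → δ a k * h k ≡ 0ℚ
  off k k≢a = trans (cong (_* h k) (δ-off (k≢a ∘ sym))) (ℚ.*-zeroˡ (h k))

∑-δʳ : ∀ {r} (a : Fin r) (h : Fin r → ℚ) → ∑ (λ k → h k * δ k a) ≡ h a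
∑-δʳ a h = trans (∑-single (λ k → h k * δ k a) a off) (trans (cong (h a *_) (δ-refl a)) (ℚ.*-identityʳ (h a)))
  where
  off : ∀ k → k ≢ a → h k * δ k a ≡ 0ℚ
  off k k≢a = trans (cong (h k *_) (δ-off k≢a)) (ℚ.*-zeroʳ (h k))

+≡0⇒≡- : ∀ {a b : ℚ} → a + b ≡ 0ℚ → a ≡ - b
+≡0⇒≡- {a} {b} a+b≡0 = begin
  a            ≡⟨ solve 2 (λ a b → a := (a :+ b) :- b) refl a b ⟩
  (a + b) - b  ≡⟨ cong (_- b) a+b≡0 ⟩
  0ℚ - b       ≡⟨ ℚ.+-identityˡ (- b) ⟩
  - b          ∎
  where open ≡-Reasoning

*-nonzero : ∀ {p q : ℚ} → p ≢ 0ℚ → q ≢ 0ℚ → p * q ≢ 0ℚ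
*-nonzero {p} {q} p≢0 q≢0 pq≡0 = q≢0 (begin
  q                  ≡⟨ sym (ℚ.*-identityˡ q) ⟩
  1ℚ * q             ≡⟨ cong (_* q) (sym (ℚ.*-inverseˡ p {{p-nonzero}})) ⟩
  p⁻¹ * p * q        ≡⟨ ℚ.*-assoc p⁻¹ p q ⟩
  p⁻¹ * (p * q)      ≡⟨ cong (p⁻¹ *_) pq≡0 ⟩
  p⁻¹ * 0ℚ           ≡⟨ ℚ.*-zeroʳ p⁻¹ ⟩
  0ℚ                 ∎)
  where
  open ≡-Reasoning
  p-nonzero : NonZero p
  p-nonzero = ≢-nonZero p≢0
  p⁻¹ : ℚ
  p⁻¹ = (1/ p) {{p-nonzero}}

neg-nonneg⇒nonpos : ∀ {x : ℚ} → 0ℚ ≤ - x → x ≤ 0ℚ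
neg-nonneg⇒nonpos {x} 0≤-x =
  ℚ.≤-trans (ℚ.≤-reflexive (solve 1 (λ x → x := :- (:- x)) refl x)) (ℚ.neg-antimono-≤ 0≤-x)

argmin : ∀ {k} (z : Fin k → ℚ) → Fin k → Σ (Fin k) λ i → ∀ w → z i ≤ z w
argmin {suc zero} z _ = zero , λ { zero → ℚ.≤-refl }
argmin {suc (suc k)} z _ with i , min ← argmin (z ∘ suc) zero | z zero ℚ.≤? z (suc i)
... | yes z₀≤ = zero , λ { zero → ℚ.≤-refl ; (suc w) → ℚ.≤-trans z₀≤ (min w) }
... | no z₀≰ = suc i , λ { zero → ℚ.<⇒≤ (ℚ.≰⇒> z₀≰) ; (suc w) → min w }

fin-init-last : ∀ {r} {P : Fin (suc r) → Set} → (∀ v → P (inject₁ v)) → P (fromℕ r) → ∀ i → P i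
fin-init-last {zero} _ P-last zero = P-last
fin-init-last {suc r} P-init _ zero = P-init zero
fin-init-last {suc r} {P} P-init P-last (suc i) = fin-init-last {P = P ∘ suc} (P-init ∘ suc) P-last i

insertAt-last-inject₁ : ∀ {A : Set} {r} (xs : Fin r → A) (x : A) (j : Fin r) →
  insertAt xs (fromℕ r) x (inject₁ j) ≡ xs j
insertAt-last-inject₁ {r = suc r} xs x zero = refl
insertAt-last-inject₁ {r = suc r} xs x (suc j) = insertAt-last-inject₁ (xs ∘ suc) x j

subset : ∀ {k} {P : Fin k → Set} → (∀ w → Dec (P w)) → Subset k
subset P? = tabulate (does ∘ P?)

∈-subset⁺ : ∀ {k} {P : Fin k → Set} (P? : ∀ w → Dec (P w)) {w} → P w → w ∈ subset P?
∈-subset⁺ P? {w} Pw = lookup⇒[]= w (subset P?) (trans (lookup∘tabulate (does ∘ P?) w) (dec-true (P? w) Pw))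

∈-subset⁻ : ∀ {k} {P : Fin k → Set} (P? : ∀ w → Dec (P w)) {w} → w ∈ subset P? → P w
∈-subset⁻ P? {w} w∈subset with P? w | trans (sym (lookup∘tabulate (does ∘ P?) w)) ([]=⇒lookup w∈subset)
... | yes Pw | _ = Pw
... | no _ | ()

-- Matrix–vector product, in the convention of LinIndepCols: (M *ᵥ x) i = Σⱼ xⱼ · M i j.
_*ᵥ_ : ∀ {m k} → Matrix m k → (Fin k → ℚ) → Fin m → ℚ
(M *ᵥ x) i = ∑ (λ j → x j * M i j)

record NontrivialKernel {m k} (A : Matrix m k) : Set where
  constructor kernel
  field
    vector : Fin k → ℚ
    annihilated : ∀ i → (A *ᵥ vector) i ≡ 0ℚ
    index : Fin k
    nonzero : vector index ≢ 0ℚ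

*ᵥ-insertAt : ∀ {m k} (A : Matrix m (suc k)) (e : Fin k → ℚ) (q : Fin (suc k)) (a : ℚ) (i : Fin m) →
  (A *ᵥ insertAt e q a) i ≡ a * A i q + ∑ (λ j → e j * A i (punchIn q j))
*ᵥ-insertAt A e q a i =
  trans (∑-remove q (λ j → insertAt e q a j * A i j))
        (cong₂ _+_ (cong (_* A i q) (insertAt-lookup e q a))
                   (∑-cong (λ j → cong (_* A i (punchIn q j)) (insertAt-punchIn e q a j))))

kernel-zero-row : ∀ {m k} (A : Matrix (suc m) (suc k)) → (∀ j → A zero j ≡ 0ℚ) →
  NontrivialKernel (λ i j → A (suc i) (suc j)) → NontrivialKernel A
kernel-zero-row {k = k} A row₀≡0 (kernel d Ad≡0 j d≢0) = kernel (insertAt d zero 0ℚ) Ac≡0 (suc j) d≢0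
  where
  drop-first : ∀ i → (A *ᵥ insertAt d zero 0ℚ) i ≡ ∑ (λ j → d j * A i (suc j))
  drop-first i = trans (cong (_+ ∑ (λ j → d j * A i (suc j))) (ℚ.*-zeroˡ (A i zero)))
                       (ℚ.+-identityˡ (∑ (λ j → d j * A i (suc j))))
  Ac≡0 : ∀ i → (A *ᵥ insertAt d zero 0ℚ) i ≡ 0ℚ
  Ac≡0 zero = trans (drop-first zero)
    (trans (∑-cong (λ j → trans (cong (d j *_) (row₀≡0 (suc j))) (ℚ.*-zeroʳ (d j)))) (∑-zero {k}))
  Ac≡0 (suc i) = trans (drop-first (suc i)) (Ad≡0 i)

-- One step of Gaussian elimination with pivot A 0 q: subtracting multiples of
-- column q clears the first row; the remaining rows and columns form this matrix.
eliminate : ∀ {m k} → Matrix (suc m) (suc k) → Fin (suc k) → Matrix m k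
eliminate A q i j = A zero q * A (suc i) (punchIn q j) - A zero (punchIn q j) * A (suc i) q

kernel-pivot : ∀ {m k} (A : Matrix (suc m) (suc k)) (q : Fin (suc k)) → A zero q ≢ 0ℚ →
  NontrivialKernel (eliminate A q) → NontrivialKernel A
kernel-pivot {m} {k} A q p≢0 (kernel d Ed≡0 j d≢0) = kernel c Ac≡0 (punchIn q j) c≢0
  where
  p : ℚ
  p = A zero q
  D : Fin (suc m) → ℚ
  D i = ∑ (λ j → d j * A i (punchIn q j))
  c : Fin (suc k) → ℚ
  c = insertAt (λ j → p * d j) q (- D zero)
  Ac : ∀ i → (A *ᵥ c) i ≡ p * D i - D zero * A i q
  Ac i = begin
    (A *ᵥ c) i
      ≡⟨ *ᵥ-insertAt A (λ j → p * d j) q (- D zero) i ⟩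
    - D zero * A i q + ∑ (λ j → p * d j * A i (punchIn q j))
      ≡⟨ cong (- D zero * A i q +_) (trans (∑-cong (λ j → ℚ.*-assoc p (d j) _))
                                           (∑-*ˡ p (λ j → d j * A i (punchIn q j)))) ⟩
    - D zero * A i q + p * D i
      ≡⟨ solve 3 (λ S K P → :- S :* K :+ P := P :- S :* K) refl (D zero) (A i q) (p * D i) ⟩
    p * D i - D zero * A i q
      ∎
    where open ≡-Reasoning
  Ed : ∀ i → (eliminate A q *ᵥ d) i ≡ p * D (suc i) - D zero * A (suc i) q
  Ed i = begin
    ∑ (λ j → d j * (p * a j - b j * K))
      ≡⟨ ∑-cong (λ j → solve 5 (λ d p a b K → d :* (p :* a :- b :* K) := p :* (d :* a) :+ (:- K) :* (d :* b))
                                refl (d j) p (a j) (b j) K) ⟩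
    ∑ (λ j → p * (d j * a j) + (- K) * (d j * b j))
      ≡⟨ ∑-+ (λ j → p * (d j * a j)) (λ j → (- K) * (d j * b j)) ⟩
    ∑ (λ j → p * (d j * a j)) + ∑ (λ j → (- K) * (d j * b j))
      ≡⟨ cong₂ _+_ (∑-*ˡ p (λ j → d j * a j)) (∑-*ˡ (- K) (λ j → d j * b j)) ⟩
    p * D (suc i) + (- K) * D zero
      ≡⟨ solve 3 (λ X K S → X :+ (:- K) :* S := X :- S :* K) refl (p * D (suc i)) K (D zero) ⟩
    p * D (suc i) - D zero * K
      ∎
    where
    open ≡-Reasoning
    a b : Fin k → ℚ
    a j = A (suc i) (punchIn q j)
    b j = A zero (punchIn q j)
    K : ℚ
    K = A (suc i) q
  Ac≡0 : ∀ i → (A *ᵥ c) i ≡ 0ℚ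
  Ac≡0 zero = trans (Ac zero) (solve 2 (λ P S → P :* S :- S :* P := con 0ℚ) refl p (D zero))
  Ac≡0 (suc i) = trans (Ac (suc i)) (trans (sym (Ed i)) (Ed≡0 i))
  c≢0 : c (punchIn q j) ≢ 0ℚ
  c≢0 = subst (_≢ 0ℚ) (sym (insertAt-punchIn (λ j → p * d j) q (- D zero) j)) (*-nonzero p≢0 d≢0)

wide-kernel : ∀ {m} (A : Matrix m (suc m)) → NontrivialKernel A
wide-kernel {zero} A = kernel (λ _ → 1ℚ) (λ ()) zero (λ ())
wide-kernel {suc m} A with any? (λ j → ¬? (A zero j ℚ.≟ 0ℚ))
... | yes (q , pivot≢0) = kernel-pivot A q pivot≢0 (wide-kernel (eliminate A q))
... | no no-pivot = kernel-zero-row A (λ j → decidable-stable (A zero j ℚ.≟ 0ℚ) (no-pivot ∘ (j ,_)))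
                                      (wide-kernel (λ i j → A (suc i) (suc j)))

scatter : ∀ {r k} → (Fin r → Fin k) → (Fin r → ℚ) → Fin k → ℚ
scatter f c l = ∑ (λ j → c j * δ (f j) l)

*ᵥ-scatter : ∀ {m r k} (M : Matrix m k) (f : Fin r → Fin k) (c : Fin r → ℚ) (i : Fin m) →
  (M *ᵥ scatter f c) i ≡ ((λ i' j → M i' (f j)) *ᵥ c) i
*ᵥ-scatter M f c i = begin
  ∑ (λ l → ∑ (λ j → c j * δ (f j) l) * M i l)  ≡⟨ ∑-cong (λ l → sym (∑-*ʳ (λ j → c j * δ (f j) l) (M i l))) ⟩
  ∑ (λ l → ∑ (λ j → c j * δ (f j) l * M i l))  ≡⟨ ∑-swap (λ l j → c j * δ (f j) l * M i l) ⟩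
  ∑ (λ j → ∑ (λ l → c j * δ (f j) l * M i l))  ≡⟨ ∑-cong (λ j → ∑-cong (λ l → ℚ.*-assoc (c j) (δ (f j) l) (M i l))) ⟩
  ∑ (λ j → ∑ (λ l → c j * (δ (f j) l * M i l))) ≡⟨ ∑-cong (λ j → ∑-*ˡ (c j) (λ l → δ (f j) l * M i l)) ⟩
  ∑ (λ j → c j * ∑ (λ l → δ (f j) l * M i l))  ≡⟨ ∑-cong (λ j → cong (c j *_) (∑-δ (f j) (M i))) ⟩
  ∑ (λ j → c j * M i (f j))                    ∎
  where open ≡-Reasoning

independent⇒last-row-escapes : ∀ {m k} (M : Matrix (suc m) k) (f : Fin (suc m) → Fin k) →
  LinIndepCols M f →
  Σ (Fin k → ℚ) λ x → (∀ u → (M *ᵥ x) (inject₁ u) ≡ 0ℚ) × (M *ᵥ x) (fromℕ m) ≢ 0ℚ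
independent⇒last-row-escapes {m} M f indep
  with kernel c top≡0 j c≢0 ← wide-kernel (λ u j → M (inject₁ u) (f j))
  = scatter f c , top , last≢0
  where
  top : ∀ u → (M *ᵥ scatter f c) (inject₁ u) ≡ 0ℚ
  top u = trans (*ᵥ-scatter M f c (inject₁ u)) (top≡0 u)
  last≢0 : (M *ᵥ scatter f c) (fromℕ m) ≢ 0ℚ
  last≢0 last≡0 = c≢0 (indep c (fin-init-last top≡0 (trans (sym (*ᵥ-scatter M f c (fromℕ m))) last≡0)) j)

-- Independent columns give full column rank, since by the pigeonhole principle a
-- k-column matrix has no k + 1 distinct columns.
full-column-rank : ∀ {m k} (M : Matrix m k) → LinIndepCols M id → HasRank M k
full-column-rank {k = k} M indep = (id , id , indep) , no-more-columns
  where
  no-more-columns : (g : Fin (suc k) → Fin k) → Injective _≡_ _≡_ g → ¬ LinIndepCols M g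
  no-more-columns g g-injective _ with i , j , i<j , gi≡gj ← pigeonhole (ℕ.n<1+n k) g
    = <-irrefl (g-injective gi≡gj) i<j

module Potential {n : ℕ} (G : DiGraph n) where

  N : ℚ
  N = ℕ→ℚ n

  B[_] : (Fin n → ℚ) → Fin n → ℚ
  B[ z ] = Bmat G *ᵥ z

  B-diagonal : ∀ u → Bmat G u u ≡ N
  B-diagonal u with u ≟ u
  ... | yes _ = solve 1 (λ N → N :* con 1ℚ :- con 0ℚ := N) refl N
  ... | no u≢u = ⊥-elim (u≢u refl)

  B-off-diagonal : ∀ {u w} → u ≢ w → (x : ℚ) → x * Bmat G u w ≡ - (if G u w then x else 0ℚ)
  B-off-diagonal {u} {w} u≢w x with u ≟ w
  ... | yes u≡w = ⊥-elim (u≢w u≡w)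
  ... | no _ with G u w
  ...   | true = solve 2 (λ N x → x :* (N :* con 0ℚ :- con 1ℚ) := :- x) refl N x
  ...   | false = solve 2 (λ N x → x :* (N :* con 0ℚ :- con 0ℚ) := :- con 0ℚ) refl N x

  off-diagonal-≤ : ∀ {u w} → u ≢ w → (x c : ℚ) → (Edge G u w → - x ≤ c) → 0ℚ ≤ c → x * Bmat G u w ≤ c
  off-diagonal-≤ {u} {w} u≢w x c edge-case non-edge-case =
    ℚ.≤-trans (ℚ.≤-reflexive (B-off-diagonal u≢w x)) (by-cases (G u w) refl)
    where
    by-cases : ∀ b → G u w ≡ b → - (if b then x else 0ℚ) ≤ c
    by-cases true edge = edge-case edge
    by-cases false _ = non-edge-case

  B-neg : ∀ (z : Fin n → ℚ) u → B[ (λ w → - z w) ] u ≡ - B[ z ] u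
  B-neg z u = trans (∑-cong (λ w → sym (ℚ.neg-distribˡ-* (z w) (Bmat G u w)))) (∑-neg (λ w → z w * Bmat G u w))

  -- Where z ≤ 0 and no out-neighbour of u has a smaller value, (B z)ᵤ ≤ z u:
  -- the diagonal contributes n·z u and each of the other n − 1 terms at most −z u.
  B-at-minimum : ∀ (z : Fin n → ℚ) u → z u ≤ 0ℚ → (∀ w → Edge G u w → z u ≤ z w) → B[ z ] u ≤ z u
  B-at-minimum z u zu≤0 neighbours = ∑-diagonal-bound (λ w → z w * Bmat G u w) u (z u) diagonal others
    where
    diagonal : z u * Bmat G u u ≤ N * z u
    diagonal = ℚ.≤-reflexive (trans (cong (z u *_) (B-diagonal u)) (ℚ.*-comm (z u) N))
    others : ∀ w → w ≢ u → z w * Bmat G u w ≤ - z u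
    others w w≢u = off-diagonal-≤ (w≢u ∘ sym) (z w) (- z u)
                     (ℚ.neg-antimono-≤ ∘ neighbours w) (ℚ.neg-antimono-≤ zu≤0)

  minimum-principle : ∀ (z : Fin n → ℚ) → (∀ u → 0ℚ ≤ B[ z ] u) → ∀ w → 0ℚ ≤ z w
  minimum-principle z Bz≥0 w with u , min ← argmin z w | 0ℚ ℚ.≤? z u
  ... | yes 0≤zu = ℚ.≤-trans 0≤zu (min w)
  ... | no 0≰zu = ⊥-elim (ℚ.<-irrefl refl (begin-strict
    0ℚ        ≤⟨ Bz≥0 u ⟩
    B[ z ] u  ≤⟨ B-at-minimum z u (ℚ.<⇒≤ zu<0) (λ w _ → min w) ⟩
    z u       <⟨ zu<0 ⟩
    0ℚ        ∎))
    where
    open ℚ.≤-Reasoning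
    zu<0 : z u < 0ℚ
    zu<0 = ℚ.≰⇒> 0≰zu

  B-kernel-trivial : ∀ (z : Fin n → ℚ) → (∀ u → B[ z ] u ≡ 0ℚ) → ∀ w → z w ≡ 0ℚ
  B-kernel-trivial z Bz≡0 w = ℚ.≤-antisym (neg-nonneg⇒nonpos (minimum-principle (λ v → - z v) -Bz≥0 w))
                                          (minimum-principle z Bz≥0 w)
    where
    Bz≥0 : ∀ u → 0ℚ ≤ B[ z ] u
    Bz≥0 u = ℚ.≤-reflexive (sym (Bz≡0 u))
    -Bz≥0 : ∀ u → 0ℚ ≤ B[ (λ v → - z v) ] u
    -Bz≥0 u = ℚ.≤-reflexive (sym (trans (B-neg z u) (cong -_ (Bz≡0 u))))

  terms-nonpositive-at-zero : ∀ (z : Fin n → ℚ) → (∀ w → 0ℚ ≤ z w) → ∀ {u} → z u ≡ 0ℚ → ∀ w → z w * Bmat G u w ≤ 0ℚ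
  terms-nonpositive-at-zero z z≥0 {u} zu≡0 w with w ≟ u
  ... | yes refl = ℚ.≤-reflexive (trans (cong (_* Bmat G w w) zu≡0) (ℚ.*-zeroˡ (Bmat G w w)))
  ... | no w≢u = off-diagonal-≤ (w≢u ∘ sym) (z w) 0ℚ (λ _ → ℚ.neg-antimono-≤ (z≥0 w)) ℚ.≤-refl

  -- For z ≥ 0 with (B z)ᵤ ≥ 0, a zero of z at u spreads to every out-neighbour of u,
  -- because the only positive contribution to (B z)ᵤ would come from the diagonal.
  zero-spreads : ∀ (z : Fin n → ℚ) → (∀ w → 0ℚ ≤ z w) → ∀ {u v} → 0ℚ ≤ B[ z ] u → Edge G u v → z u ≡ 0ℚ → z v ≡ 0ℚ
  zero-spreads z z≥0 {u} {v} Bzu≥0 edge zu≡0 with v ≟ u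
  ... | yes refl = zu≡0
  ... | no v≢u = ℚ.≤-antisym (neg-nonneg⇒nonpos (begin
    0ℚ                ≤⟨ Bzu≥0 ⟩
    B[ z ] u          ≤⟨ ∑≤term (λ w → z w * Bmat G u w) v (λ w _ → terms-nonpositive-at-zero z z≥0 zu≡0 w) ⟩
    z v * Bmat G u v  ≡⟨ B-off-diagonal (v≢u ∘ sym) (z v) ⟩
    - (if G u v then z v else 0ℚ) ≡⟨ cong (λ b → - (if b then z v else 0ℚ)) edge ⟩
    - z v             ∎)) (z≥0 v)
    where open ℚ.≤-Reasoning

  HarmonicOff : Fin n → (Fin n → ℚ) → Set
  HarmonicOff t z = ∀ u → u ≢ t → B[ z ] u ≡ 0ℚ

  harmonic-neg : ∀ {t} (z : Fin n → ℚ) → HarmonicOff t z → HarmonicOff t (λ w → - z w)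
  harmonic-neg z harmonic u u≢t = trans (B-neg z u) (cong -_ (harmonic u u≢t))

  -- If z is harmonic off t and (B z)_t > 0, then z vanishes at no vertex that reaches t:
  -- z ≥ 0 by the minimum principle, and a zero would spread along the path to t,
  -- where it forces (B z)_t ≤ 0.
  path⇒nonzero⁺ : ∀ {s t} (z : Fin n → ℚ) → HarmonicOff t z → 0ℚ < B[ z ] t → HasPath G s t → z s ≢ 0ℚ
  path⇒nonzero⁺ {t = t} z harmonic Bzt>0 = walk
    where
    Bz≥0 : ∀ u → 0ℚ ≤ B[ z ] u
    Bz≥0 u with u ≟ t
    ... | yes refl = ℚ.<⇒≤ Bzt>0
    ... | no u≢t = ℚ.≤-reflexive (sym (harmonic u u≢t))
    z≥0 : ∀ w → 0ℚ ≤ z w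
    z≥0 = minimum-principle z Bz≥0
    walk : ∀ {u} → HasPath G u t → z u ≢ 0ℚ
    walk ε zt≡0 = ℚ.<-irrefl refl (begin-strict
      0ℚ                    <⟨ Bzt>0 ⟩
      B[ z ] t              ≤⟨ ∑-mono (terms-nonpositive-at-zero z z≥0 zt≡0) ⟩
      ∑ {n} (λ _ → 0ℚ)      ≡⟨ ∑-zero {n} ⟩
      0ℚ                    ∎)
      where open ℚ.≤-Reasoning
    walk {u} (edge ◅ path) zu≡0 = walk path (zero-spreads z z≥0 (Bz≥0 u) edge zu≡0)

  path⇒nonzero : ∀ {s t} (z : Fin n → ℚ) → HarmonicOff t z → B[ z ] t ≢ 0ℚ → HasPath G s t → z s ≢ 0ℚ
  path⇒nonzero {t = t} z harmonic Bzt≢0 path with ℚ.<-cmp (B[ z ] t) 0ℚ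
  ... | tri< Bzt<0 _ _ = λ zs≡0 →
    path⇒nonzero⁺ (λ w → - z w) (harmonic-neg z harmonic)
      (subst (0ℚ <_) (sym (B-neg z t)) (ℚ.neg-antimono-< Bzt<0)) path (cong -_ zs≡0)
  ... | tri≈ _ Bzt≡0 _ = ⊥-elim (Bzt≢0 Bzt≡0)
  ... | tri> _ _ Bzt>0 = path⇒nonzero⁺ z harmonic Bzt>0 path

  -- Conversely, from a vertex where a potential harmonic off t is positive one climbs
  -- to t through strictly increasing values.
  module Climb {t : Fin n} (z : Fin n → ℚ) (harmonic : HarmonicOff t z) where

    -- The vertices with a strictly larger value than u; climbing shrinks this set.
    above? : ∀ u w → Dec (z u < z w)
    above? u w = z u ℚ.<? z w

    above : Fin n → Subset n
    above u = subset (above? u)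

    above-shrinks : ∀ {u w} → z u < z w → ∣ above w ∣ <ₙ ∣ above u ∣
    above-shrinks {u} {w} zu<zw = p⊂q⇒∣p∣<∣q∣
      ( (λ x∈above-w → ∈-subset⁺ (above? u) (ℚ.<-trans zu<zw (∈-subset⁻ (above? w) x∈above-w)))
      , w , ∈-subset⁺ (above? u) zu<zw , (λ w∈above-w → ℚ.<-irrefl refl (∈-subset⁻ (above? w) w∈above-w)) )

    -- At u ≠ t with z u > 0 some out-neighbour has a strictly larger value: otherwise
    -- −z has a local minimum −z u < 0 at u, and (B(−z))ᵤ ≤ −z u < 0 contradicts harmonicity.
    higher-neighbour : ∀ {u} → u ≢ t → 0ℚ < z u → ∃ λ w → Edge G u w × z u < z w
    higher-neighbour {u} u≢t zu>0 with any? (λ w → (G u w Data.Bool.≟ true) ×-dec above? u w)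
    ... | yes found = found
    ... | no none = ⊥-elim (ℚ.<-irrefl refl (begin-strict
      0ℚ                        ≡⟨ sym (harmonic-neg z harmonic u u≢t) ⟩
      B[ (λ w → - z w) ] u      ≤⟨ B-at-minimum (λ w → - z w) u (ℚ.<⇒≤ -zu<0) not-higher ⟩
      - z u                     <⟨ -zu<0 ⟩
      0ℚ                        ∎))
      where
      open ℚ.≤-Reasoning
      -zu<0 : - z u < 0ℚ
      -zu<0 = ℚ.neg-antimono-< zu>0
      not-higher : ∀ w → Edge G u w → - z u ≤ - z w
      not-higher w edge = ℚ.neg-antimono-≤ (ℚ.≮⇒≥ (λ zu<zw → none (w , edge , zu<zw)))

    climb : ∀ k {u} → ∣ above u ∣ <ₙ k → 0ℚ < z u → HasPath G u t
    climb (suc k) {u} bound zu>0 with u ≟ t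
    ... | yes refl = ε
    ... | no u≢t with w , edge , zu<zw ← higher-neighbour u≢t zu>0
      = edge ◅ climb k (ℕ.<-≤-trans (above-shrinks zu<zw) (s≤s⁻¹ bound)) (ℚ.<-trans zu>0 zu<zw)

    positive⇒path : ∀ {u} → 0ℚ < z u → HasPath G u t
    positive⇒path {u} = climb _ (ℕ.n<1+n ∣ above u ∣)

  nonzero⇒path : ∀ {s t} (z : Fin n → ℚ) → HarmonicOff t z → z s ≢ 0ℚ → HasPath G s t
  nonzero⇒path {s} z harmonic zs≢0 with ℚ.<-cmp (z s) 0ℚ
  ... | tri< zs<0 _ _ = Climb.positive⇒path (λ w → - z w) (harmonic-neg z harmonic) (ℚ.neg-antimono-< zs<0)
  ... | tri≈ _ zs≡0 _ = ⊥-elim (zs≢0 zs≡0)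
  ... | tri> _ _ zs>0 = Climb.positive⇒path z harmonic zs>0

module Augmented {n : ℕ} (G : DiGraph n) (s t : Fin n) where
  open Potential G

  M : Matrix (suc n) (suc n)
  M = augMatrix G s t

  entry-BB : ∀ u v → M (inject₁ u) (inject₁ v) ≡ Bmat G u v
  entry-BB u v = trans (insertAt-last-inject₁ (B'mat G s (inject₁ u)) (b'vec t (inject₁ u)) v)
                       (cong (λ row → row v) (insertAt-last-inject₁ (Bmat G) (unitVec s) u))

  entry-Bb : ∀ u → M (inject₁ u) (fromℕ n) ≡ δ u t
  entry-Bb u = trans (insertAt-lookup (B'mat G s (inject₁ u)) (fromℕ n) (b'vec t (inject₁ u)))
                     (insertAt-last-inject₁ (unitVec t) 0ℚ u)

  entry-sB : ∀ v → M (fromℕ n) (inject₁ v) ≡ δ v s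
  entry-sB v = trans (insertAt-last-inject₁ (B'mat G s (fromℕ n)) (b'vec t (fromℕ n)) v)
                     (cong (λ row → row v) (insertAt-lookup (Bmat G) (fromℕ n) (unitVec s)))

  entry-sb : M (fromℕ n) (fromℕ n) ≡ 0ℚ
  entry-sb = trans (insertAt-lookup (B'mat G s (fromℕ n)) (fromℕ n) (b'vec t (fromℕ n)))
                   (insertAt-lookup (unitVec t) (fromℕ n) 0ℚ)

  row-top : ∀ x u → (M *ᵥ x) (inject₁ u) ≡ B[ init x ] u + last x * δ u t
  row-top x u = trans (∑-init-last (λ j → x j * M (inject₁ u) j))
    (cong₂ _+_ (∑-cong (λ v → cong (init x v *_) (entry-BB u v))) (cong (last x *_) (entry-Bb u)))

  row-last : ∀ x → (M *ᵥ x) (fromℕ n) ≡ init x s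
  row-last x = begin
    (M *ᵥ x) (fromℕ n)                                   ≡⟨ ∑-init-last (λ j → x j * M (fromℕ n) j) ⟩
    ∑ (λ v → init x v * M (fromℕ n) (inject₁ v)) + last x * M (fromℕ n) (fromℕ n)
      ≡⟨ cong₂ _+_ (∑-cong (λ v → cong (init x v *_) (entry-sB v))) (cong (last x *_) entry-sb) ⟩
    ∑ (λ v → init x v * δ v s) + last x * 0ℚ            ≡⟨ cong₂ _+_ (∑-δʳ s (init x)) (ℚ.*-zeroʳ (last x)) ⟩
    init x s + 0ℚ                                        ≡⟨ ℚ.+-identityʳ (init x s) ⟩
    init x s                                             ∎
    where open ≡-Reasoning

  top-zero⇒harmonic : ∀ x → (∀ u → (M *ᵥ x) (inject₁ u) ≡ 0ℚ) → HarmonicOff t (init x)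
  top-zero⇒harmonic x top≡0 u u≢t = begin
    B[ init x ] u                       ≡⟨ sym (ℚ.+-identityʳ _) ⟩
    B[ init x ] u + 0ℚ                  ≡⟨ cong (B[ init x ] u +_) (sym no-target-term) ⟩
    B[ init x ] u + last x * δ u t      ≡⟨ sym (row-top x u) ⟩
    (M *ᵥ x) (inject₁ u)                ≡⟨ top≡0 u ⟩
    0ℚ                                  ∎
    where
    open ≡-Reasoning
    no-target-term : last x * δ u t ≡ 0ℚ
    no-target-term = trans (cong (last x *_) (δ-off u≢t)) (ℚ.*-zeroʳ (last x))

  -- (⇒) Along a path s ⇝ t the kernel of M is trivial: in M x = 0 first α = 0,
  -- since otherwise y would be harmonic off t with (B y)_t = −α ≠ 0 but y_s = 0;
  -- then B y = 0, so y = 0.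
  path⇒independent : HasPath G s t → LinIndepCols M id
  path⇒independent path x Mx≡0 = fin-init-last y≡0 α≡0
    where
    y : Fin n → ℚ
    y = init x
    α : ℚ
    α = last x
    By : ∀ u → B[ y ] u ≡ - (α * δ u t)
    By u = +≡0⇒≡- (trans (sym (row-top x u)) (Mx≡0 (inject₁ u)))
    ys≡0 : y s ≡ 0ℚ
    ys≡0 = trans (sym (row-last x)) (Mx≡0 (fromℕ n))
    α≡0 : α ≡ 0ℚ
    α≡0 with α ℚ.≟ 0ℚ
    ... | yes α≡0 = α≡0
    ... | no α≢0 = ⊥-elim (path⇒nonzero y (top-zero⇒harmonic x (Mx≡0 ∘ inject₁)) Byt≢0 path ys≡0)
      where
      Byt≢0 : B[ y ] t ≢ 0ℚ
      Byt≢0 Byt≡0 = α≢0 (ℚ.neg-injective (begin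
        - α                 ≡⟨ solve 1 (λ a → :- a := :- (a :* con 1ℚ)) refl α ⟩
        - (α * 1ℚ)          ≡⟨ cong (λ d → - (α * d)) (sym (δ-refl t)) ⟩
        - (α * δ t t)       ≡⟨ sym (By t) ⟩
        B[ y ] t            ≡⟨ Byt≡0 ⟩
        0ℚ                  ∎))
        where open ≡-Reasoning
    y≡0 : ∀ u → y u ≡ 0ℚ
    y≡0 = B-kernel-trivial y (λ u → trans (By u) (cong -_ (trans (cong (_* δ u t) α≡0) (ℚ.*-zeroˡ (δ u t)))))

  independent⇒path : ∀ {f} → LinIndepCols M f → HasPath G s t
  independent⇒path {f} indep =
    nonzero⇒path (init x) (top-zero⇒harmonic x top≡0) (last≢0 ∘ trans (row-last x))
    where
    escape : Σ (Fin (suc n) → ℚ) λ x → (∀ u → (M *ᵥ x) (inject₁ u) ≡ 0ℚ) × (M *ᵥ x) (fromℕ n) ≢ 0ℚ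
    escape = independent⇒last-row-escapes M f indep
    x : Fin (suc n) → ℚ
    x = proj₁ escape
    top≡0 : ∀ u → (M *ᵥ x) (inject₁ u) ≡ 0ℚ
    top≡0 = proj₁ (proj₂ escape)
    last≢0 : (M *ᵥ x) (fromℕ n) ≢ 0ℚ
    last≢0 = proj₂ (proj₂ escape)

corollary1 : (n : ℕ) (G : DiGraph n) (s t : Fin n) →
    HasPath G s t ⇔ HasRank (augMatrix G s t) (suc n)
corollary1 n G s t = mk⇔
  (λ path → full-column-rank (augMatrix G s t) (path⇒independent path))
  (λ { ((f , _ , independent) , _) → independent⇒path {f} independent })
  where open Augmented G s t
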